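{- Let $G$ be an interval graph, $D_s\neq D_t$ dominating multisets of the same size, and $M$ a minimum-cost matching between $D_s$ and $D_t$ such that there is no $(u,v)\in M$ and $u'\in S(u,v)$ with $(D_s\setminus\{u\})\cup\{u'\}$ dominating, and no $(u,v)\in M$ and $v'\in S(v,u)$ with $(D_t\setminus\{v\})\cup\{v'\}$ dominating. Then one can compute (by choosing $v\in D_s\triangle D_t$ with minimum right endpoint, say $v\in D_s$ up to symmetry, and finding $y\in D_t\setminus D_s$, $y'$ matched to $y$ and $v'$ matched to $v$ with $(D_s\setminus\{v\})\cup\{y\}$ dominating, then setting $M'=(M\setminus\{(v,v'),(y',y)\})\cup\{(v,y),(y',v')\}$) a minimum-cost matching $M'$ between $D_s$ and $D_t$ such that at least one of the following holds. \begin{itemize} \item There is $(u, v) \in M', u' \in S(u, v)$ such that $(D_s\setminus\{u\})\cup\{u'\}$ is dominating, \item there is $(u, v) \in M', v' \in S(v, u)$ such that $(D_t\setminus\{v\})\cup\{v'\}$ is dominating. \end{itemize}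
   Context: $S(u,v)$ denotes the set of vertices that follow $u$ on some shortest path from $u$ to $v$ (with $S(u,u)=\emptyset$). Interval graphs are given with an interval representation $I(v)=[\ell(v),r(v)]$ with distinct integer endpoints. A multiset is dominating if its support is a dominating set. A matching between multisets $D_s,D_t$ is a multiset $M\subseteq D_s\times D_t$ where each $v$ appears $D_s(v)$ times as a first coordinate and $D_t(v)$ times as a second coordinate; its cost is $\sum_{(u,v)\in M}d_G(u,v)M(u,v)$, and it is minimum-cost if no matching has smaller cost. $D_s\triangle D_t=(D_s\setminus D_t)\cup(D_t\setminus D_s)$. -}

module Defs where

open import Data.Nat using (ℕ; zero; suc; _+_; _*_; _∸_; _≤_; _<_)
open import Data.Fin using (Fin; zero; suc; _≟_)
open import Data.Bool using (if_then_else_)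
open import Data.Product using (Σ; _×_; ∃-syntax)
open import Data.Sum using (_⊎_)
open import Relation.Nullary using (¬_; does)
open import Relation.Binary.PropositionalEquality using (_≡_; _≢_)

∑ : ∀ {n} → (Fin n → ℕ) → ℕ
∑ {zero}  f = 0
∑ {suc n} f = f zero + ∑ (λ i → f (suc i))

-- Interval representation of an interval graph on vertex set Fin n:
-- I(v) = [ℓ v , r v], all 2n endpoints distinct integers (natural numbers,
-- w.l.o.g. after shifting).
record IntervalRep (n : ℕ) : Set where
  field
    ℓ r      : Fin n → ℕ
    ℓ<r      : ∀ v → ℓ v < r v
    ℓ-inj    : ∀ u v → ℓ u ≡ ℓ v → u ≡ v
    r-inj    : ∀ u v → r u ≡ r v → u ≡ v
    ℓ≢r      : ∀ u v → ℓ u ≢ r v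

Adj : ∀ {n} → IntervalRep n → Fin n → Fin n → Set
Adj I u v = u ≢ v × ℓ u ≤ r v × ℓ v ≤ r u
  where open IntervalRep I

data Walk {n : ℕ} (E : Fin n → Fin n → Set) : Fin n → Fin n → ℕ → Set where
  nil  : ∀ {u} → Walk E u u 0
  cons : ∀ {u w v k} → E u w → Walk E w v k → Walk E u v (suc k)

IsDistance : ∀ {n} → (Fin n → Fin n → Set) → (Fin n → Fin n → ℕ) → Set
IsDistance {n} E d = ∀ (u v : Fin n) →
  Walk E u v (d u v) × (∀ k → Walk E u v k → d u v ≤ k)

-- w ∈ S(u,v): w follows u on some shortest u–v path.
InS : ∀ {n} → (Fin n → Fin n → Set) → (Fin n → Fin n → ℕ) →
      Fin n → Fin n → Fin n → Set
InS E d u v w = E u w × d u v ≡ suc (d w v)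

Multiset : ℕ → Set
Multiset n = Fin n → ℕ

size : ∀ {n} → Multiset n → ℕ
size = ∑

single : ∀ {n} → Fin n → Multiset n
single u x = if does (x ≟ u) then 1 else 0

move : ∀ {n} → Multiset n → Fin n → Fin n → Multiset n
move D u u' x = (D x ∸ single u x) + single u' x

Dominating : ∀ {n} → (Fin n → Fin n → Set) → Multiset n → Set
Dominating {n} E D = ∀ (x : Fin n) → (0 < D x) ⊎ (∃[ w ] (E x w × 0 < D w))

PairMultiset : ℕ → Set
PairMultiset n = Fin n → Fin n → ℕ

IsMatching : ∀ {n} → Multiset n → Multiset n → PairMultiset n → Set
IsMatching {n} Ds Dt M =
  (∀ (u : Fin n) → ∑ (λ v → M u v) ≡ Ds u) ×
  (∀ (v : Fin n) → ∑ (λ u → M u v) ≡ Dt v)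

cost : ∀ {n} → (Fin n → Fin n → ℕ) → PairMultiset n → ℕ
cost d M = ∑ (λ u → ∑ (λ v → d u v * M u v))

IsMinCostMatching : ∀ {n} → (Fin n → Fin n → ℕ) → Multiset n → Multiset n →
                    PairMultiset n → Set
IsMinCostMatching {n} d Ds Dt M =
  IsMatching Ds Dt M ×
  (∀ (M' : PairMultiset n) → IsMatching Ds Dt M' → cost d M ≤ cost d M')

ImprovS : ∀ {n} → (Fin n → Fin n → Set) → (Fin n → Fin n → ℕ) →
          Multiset n → PairMultiset n → Set
ImprovS E d Ds M =
  ∃[ u ] ∃[ v ] ∃[ u' ] (0 < M u v × InS E d u v u' × Dominating E (move Ds u u'))

ImprovT : ∀ {n} → (Fin n → Fin n → Set) → (Fin n → Fin n → ℕ) →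
          Multiset n → PairMultiset n → Set
ImprovT E d Dt M =
  ∃[ u ] ∃[ v ] ∃[ v' ] (0 < M u v × InS E d v u v' × Dominating E (move Dt v v'))

-- Pick v ∈ Ds △ Dt with the leftmost right endpoint, say Ds v > Dt v, and a partner v' ≠ v of v
-- in M. Shortcutting u → w → x to u → x keeps a matching minimum-cost and removes off-diagonal
-- pairs, so after finitely many shortcuts v' ∈ Dt ∖ Ds, and below the partner y' of y is v or lies
-- in Ds ∖ Dt. Let h follow v on a geodesic to v'. If Ds − v + h is dominating we are done.
-- Otherwise the undominated vertex lies left of h and is dominated in Dt by some y ∈ Dt ∖ Ds ending
-- right of v; the leftmost such y makes Ds − v + y dominating. Either y ∈ S(v,v'), or y ends
-- before h; then h lies between y and y', so d(y',h) ≤ d(y',y), and exchanging (v,v'),(y',y)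
-- for (v,y),(y',v') does not increase the cost, while (v,y) with y ∈ S(v,y) is the improvement.

module Submission where

open import Defs
open import Data.Nat using (ℕ)
open import Data.Fin using (Fin)
open import Data.Product using (Σ; _×_)
open import Data.Sum using (_⊎_)
open import Relation.Nullary using (¬_)
open import Relation.Binary.PropositionalEquality using (_≡_)

open import Data.Bool using (if_then_else_)
open import Data.Empty using (⊥-elim)
open import Data.Fin using (zero; suc; _≟_; punchIn; punchOut)
open import Data.Fin.Properties using (punchInᵢ≢i; punchIn-punchOut; any?; all?; ¬∀⟶∃¬)
open import Data.Nat using (zero; suc; _+_; _*_; _∸_; _≤_; _<_; _≤?_; _<?_; z≤n; s≤s)
open import Data.Nat.Induction using (<-wellFounded)
open import Data.Nat.Properties hiding (_≟_)
open import Data.Nat.Properties using () renaming (_≟_ to _≟ℕ_)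
open import Data.Product using (_,_; proj₁; proj₂; ∃-syntax)
open import Data.Sum using (inj₁; inj₂)
open import Function using (_∘_)
open import Induction.WellFounded using (Acc; acc)
open import Relation.Binary.Definitions using (tri<; tri≈; tri>)
open import Relation.Binary.PropositionalEquality
  using (_≢_; _≗_; refl; sym; trans; cong; cong₂; subst; subst₂; module ≡-Reasoning)
open import Relation.Nullary using (Dec; yes; no; does)
open import Relation.Nullary.Decidable using (toSum; _×-dec_; _⊎-dec_; ¬?)

open import Algebra.Properties.CommutativeMonoid.Sum +-0-commutativeMonoid
  using (sum; sum-cong-≗; sum-remove; sum-replicate-zero) renaming (∑-comm to sum-comm; ∑-distrib-+ to sum-distrib-+)
open import Algebra.Properties.Semiring.Sum +-*-semiring using (*-distribˡ-sum)

-- Sums and minima over Fin n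

∑≡sum : ∀ {n} (f : Fin n → ℕ) → ∑ f ≡ sum f
∑≡sum {zero}  f = refl
∑≡sum {suc n} f = cong (f zero +_) (∑≡sum (f ∘ suc))

∑-cong : ∀ {n} {f g : Fin n → ℕ} → f ≗ g → ∑ f ≡ ∑ g
∑-cong {f = f} {g} f≗g = begin
  ∑ f   ≡⟨ ∑≡sum f ⟩
  sum f ≡⟨ sum-cong-≗ f≗g ⟩
  sum g ≡⟨ ∑≡sum g ⟨
  ∑ g   ∎
  where open ≡-Reasoning

∑-zero : ∀ n → ∑ {n} (λ _ → 0) ≡ 0
∑-zero n = trans (∑≡sum {n} (λ _ → 0)) (sum-replicate-zero n)

∑-distrib-+ : ∀ {n} (f g : Fin n → ℕ) → ∑ (λ i → f i + g i) ≡ ∑ f + ∑ g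
∑-distrib-+ f g = begin
  ∑ (λ i → f i + g i)   ≡⟨ ∑≡sum (λ i → f i + g i) ⟩
  sum (λ i → f i + g i) ≡⟨ sum-distrib-+ f g ⟩
  sum f + sum g         ≡⟨ cong₂ _+_ (∑≡sum f) (∑≡sum g) ⟨
  ∑ f + ∑ g             ∎
  where open ≡-Reasoning

∑-balance : ∀ {n} {f f' g h : Fin n → ℕ} → (∀ i → f' i + g i ≡ f i + h i) → ∑ f' + ∑ g ≡ ∑ f + ∑ h
∑-balance {f = f} {f'} {g} {h} balanced = begin
  ∑ f' + ∑ g             ≡⟨ ∑-distrib-+ f' g ⟨
  ∑ (λ i → f' i + g i)   ≡⟨ ∑-cong balanced ⟩
  ∑ (λ i → f i + h i)    ≡⟨ ∑-distrib-+ f h ⟩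
  ∑ f + ∑ h              ∎
  where open ≡-Reasoning

*-distribˡ-∑ : ∀ {n} (c : ℕ) (f : Fin n → ℕ) → c * ∑ f ≡ ∑ (λ i → c * f i)
*-distribˡ-∑ c f = begin
  c * ∑ f               ≡⟨ cong (c *_) (∑≡sum f) ⟩
  c * sum f             ≡⟨ *-distribˡ-sum c f ⟩
  sum (λ i → c * f i)   ≡⟨ ∑≡sum (λ i → c * f i) ⟨
  ∑ (λ i → c * f i)     ∎
  where open ≡-Reasoning

∑-comm : ∀ {m n} (f : Fin m → Fin n → ℕ) →
         ∑ (λ i → ∑ (λ j → f i j)) ≡ ∑ (λ j → ∑ (λ i → f i j))
∑-comm f = begin
  ∑ (λ i → ∑ (λ j → f i j))     ≡⟨ ∑∑≡sumsum f ⟩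
  sum (λ i → sum (λ j → f i j)) ≡⟨ sum-comm f ⟩
  sum (λ j → sum (λ i → f i j)) ≡⟨ ∑∑≡sumsum (λ j i → f i j) ⟨
  ∑ (λ j → ∑ (λ i → f i j))     ∎
  where
  open ≡-Reasoning
  ∑∑≡sumsum : ∀ {m n} (g : Fin m → Fin n → ℕ) → ∑ (λ i → ∑ (g i)) ≡ sum (λ i → sum (g i))
  ∑∑≡sumsum g = trans (∑≡sum (λ i → ∑ (g i))) (sum-cong-≗ (λ i → ∑≡sum (g i)))

∑-punchIn : ∀ {n} (f : Fin (suc n) → ℕ) (i : Fin (suc n)) → ∑ f ≡ f i + ∑ (f ∘ punchIn i)
∑-punchIn f i = begin
  ∑ f                     ≡⟨ ∑≡sum f ⟩
  sum f                   ≡⟨ sum-remove f ⟩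
  f i + sum (f ∘ punchIn i) ≡⟨ cong (f i +_) (∑≡sum (f ∘ punchIn i)) ⟨
  f i + ∑ (f ∘ punchIn i) ∎
  where open ≡-Reasoning

≤-∑ : ∀ {n} (f : Fin n → ℕ) (i : Fin n) → f i ≤ ∑ f
≤-∑ {suc n} f i = subst (f i ≤_) (sym (∑-punchIn f i)) (m≤m+n (f i) _)

+-≤-∑ : ∀ {n} (f : Fin n → ℕ) {i j : Fin n} → i ≢ j → f i + f j ≤ ∑ f
+-≤-∑ {suc n} f {i} {j} i≢j = subst (f i + f j ≤_) (sym (∑-punchIn f i))
  (+-monoʳ-≤ (f i) (subst (_≤ ∑ (f ∘ punchIn i)) (cong f (punchIn-punchOut i≢j))
                         (≤-∑ (f ∘ punchIn i) (punchOut i≢j))))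

∃-positive-term : ∀ {n} (f : Fin n → ℕ) → 0 < ∑ f → ∃[ j ] 0 < f j
∃-positive-term {suc n} f 0<∑ with f zero in eq
... | suc _ = zero , subst (0 <_) (sym eq) (s≤s z≤n)
... | zero  with ∃-positive-term (f ∘ suc) 0<∑
...   | j , 0<fj = suc j , 0<fj

∃-other-positive-term : ∀ {n} (f : Fin n → ℕ) (i : Fin n) → f i < ∑ f → ∃[ j ] j ≢ i × 0 < f j
∃-other-positive-term {suc n} f i fi<∑
  with ∃-positive-term (f ∘ punchIn i)
         (+-cancelˡ-< (f i) 0 _ (subst₂ _<_ (sym (+-identityʳ (f i))) (∑-punchIn f i) fi<∑))
... | j , 0<fj = punchIn i j , punchInᵢ≢i i j , 0<fj



argmin : ∀ {n} {P : Fin n → Set} → (∀ x → Dec (P x)) → (f : Fin n → ℕ) → ∀ {x} → P x →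
         ∃[ y ] (P y × ∀ z → P z → f y ≤ f z)
argmin {n} {P} P? f {x} Px = descend x Px (<-wellFounded (f x))
  where
  descend : ∀ x → P x → Acc _<_ (f x) → ∃[ y ] (P y × ∀ z → P z → f y ≤ f z)
  descend x Px (acc rs) with any? (λ z → P? z ×-dec (f z <? f x))
  ... | yes (z , Pz , fz<fx) = descend z Pz (rs fz<fx)
  ... | no  ¬smaller         = x , Px , λ z Pz → ≮⇒≥ (λ fz<fx → ¬smaller (z , Pz , fz<fx))

-- Multisets and domination

single-≡ : ∀ {n} (a : Fin n) → single a a ≡ 1
single-≡ a with a ≟ a
... | yes _   = refl
... | no  a≢a = ⊥-elim (a≢a refl)

single-≢ : ∀ {n} {a u : Fin n} → u ≢ a → single a u ≡ 0
single-≢ {a = a} {u} u≢a with u ≟ a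
... | yes u≡a = ⊥-elim (u≢a u≡a)
... | no  _   = refl

∑-select : ∀ {n} (f : Fin n → ℕ) (b : Fin n) → ∑ (λ i → f i * single b i) ≡ f b
∑-select {suc n} f b = begin
  ∑ (λ i → f i * single b i)                      ≡⟨ ∑-punchIn (λ i → f i * single b i) b ⟩
  f b * single b b + ∑ (λ j → g j * single b (punchIn b j))
    ≡⟨ cong₂ _+_ (cong (f b *_) (single-≡ b)) (∑-cong (λ j → cong (g j *_) (single-≢ (punchInᵢ≢i b j)))) ⟩
  f b * 1 + ∑ (λ j → g j * 0)
    ≡⟨ cong₂ _+_ (*-identityʳ (f b)) (trans (∑-cong (*-zeroʳ ∘ g)) (∑-zero n)) ⟩
  f b + 0                                         ≡⟨ +-identityʳ (f b) ⟩
  f b                                             ∎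
  where
  g : Fin n → ℕ
  g = f ∘ punchIn b
  open ≡-Reasoning

∑-single : ∀ {n} (b : Fin n) → ∑ (single b) ≡ 1
∑-single b = trans (∑-cong (λ i → sym (*-identityˡ (single b i)))) (∑-select (λ _ → 1) b)

move-keeps : ∀ {n} (D : Multiset n) {u u' x : Fin n} → x ≢ u → 0 < D x → 0 < move D u u' x
move-keeps D {u} {u'} {x} x≢u 0<Dx = ≤-trans 0<Dx (≤-trans (≤-reflexive (cong (D x ∸_) (sym (single-≢ x≢u))))
                                                         (m≤m+n (D x ∸ single u x) (single u' x)))

move-adds : ∀ {n} (D : Multiset n) (u u' : Fin n) → 0 < move D u u' u'
move-adds D u u' = ≤-trans (≤-reflexive (sym (single-≡ u'))) (m≤n+m (single u' u') (D u' ∸ single u u'))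

move-keeps-surplus : ∀ {n} (D : Multiset n) {u : Fin n} (u' : Fin n) → 2 ≤ D u → 0 < move D u u' u
move-keeps-surplus D {u} u' 2≤Du = ≤-trans (∸-monoˡ-≤ 1 2≤Du)
  (≤-trans (≤-reflexive (cong (D u ∸_) (sym (single-≡ u)))) (m≤m+n (D u ∸ single u u) (single u' u)))

Dominates : ∀ {n} → (Fin n → Fin n → Set) → Multiset n → Fin n → Set
Dominates E D x = (0 < D x) ⊎ ∃[ w ] (E x w × 0 < D w)

module _ {n} {E : Fin n → Fin n → Set} where

  ¬dominates-move⇒≡⊎adj : ∀ {D u u' x} → Dominates E D x → ¬ Dominates E (move D u u') x → x ≡ u ⊎ E x u
  ¬dominates-move⇒≡⊎adj {D} {u} {x = x} (inj₁ 0<Dx) ¬dominates with toSum (x ≟ u)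
  ... | inj₁ x≡u = inj₁ x≡u
  ... | inj₂ x≢u = ⊥-elim (¬dominates (inj₁ (move-keeps D x≢u 0<Dx)))
  ¬dominates-move⇒≡⊎adj {D} {u} (inj₂ (w , e , 0<Dw)) ¬dominates with toSum (w ≟ u)
  ... | inj₁ refl = inj₂ e
  ... | inj₂ w≢u  = ⊥-elim (¬dominates (inj₂ (w , e , move-keeps D w≢u 0<Dw)))

  module _ (E? : ∀ u w → Dec (E u w)) where

    dominates? : ∀ D x → Dec (Dominates E D x)
    dominates? D x = (0 <? D x) ⊎-dec any? (λ w → E? x w ×-dec (0 <? D w))

    dominating? : ∀ D → Dec (Dominating E D)
    dominating? D = all? (dominates? D)

    undominated : ∀ {D} → ¬ Dominating E D → ∃[ x ] ¬ Dominates E D x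
    undominated {D} = ¬∀⟶∃¬ n (Dominates E D) (dominates? D)

-- Matchings and exchanges

single² : ∀ {n} → Fin n → Fin n → PairMultiset n
single² a b u w = single a u * single b w

single²-≡ : ∀ {n} (a b : Fin n) → single² a b a b ≡ 1
single²-≡ a b rewrite single-≡ a | single-≡ b = refl

single²-≢ : ∀ {n} {a b u w : Fin n} → ¬ (u ≡ a × w ≡ b) → single² a b u w ≡ 0
single²-≢ {a = a} {b} {u} {w} ≢ab with u ≟ a | w ≟ b
... | no _     | _       = refl
... | yes _    | no _    = refl
... | yes u≡a  | yes w≡b = ⊥-elim (≢ab (u≡a , w≡b))

single²-≤ : ∀ {n} (M : PairMultiset n) {a b : Fin n} → 0 < M a b → ∀ u w → single² a b u w ≤ M u w
single²-≤ M {a} {b} 0<Mab u w with u ≟ a ×-dec w ≟ b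
... | yes (refl , refl) rewrite single²-≡ a b = 0<Mab
... | no ≢ab            rewrite single²-≢ {a = a} {b} {u} {w} ≢ab = z≤n

∑-row-single² : ∀ {n} (a b u : Fin n) → ∑ (single² a b u) ≡ single a u
∑-row-single² a b u = begin
  ∑ (λ w → single a u * single b w) ≡⟨ *-distribˡ-∑ (single a u) (single b) ⟨
  single a u * ∑ (single b)         ≡⟨ cong (single a u *_) (∑-single b) ⟩
  single a u * 1                    ≡⟨ *-identityʳ (single a u) ⟩
  single a u                        ∎
  where open ≡-Reasoning

∑-column-single² : ∀ {n} (a b w : Fin n) → ∑ (λ u → single² a b u w) ≡ single b w
∑-column-single² a b w = trans (∑-cong (λ u → *-comm (single a u) (single b w))) (∑-row-single² b a w)

cost-+ : ∀ {n} (W : Fin n → Fin n → ℕ) (X Y : PairMultiset n) →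
         cost W (λ u w → X u w + Y u w) ≡ cost W X + cost W Y
cost-+ W X Y = trans
  (∑-cong λ u → trans (∑-cong λ w → *-distribˡ-+ (W u w) (X u w) (Y u w))
                      (∑-distrib-+ (λ w → W u w * X u w) (λ w → W u w * Y u w)))
  (∑-distrib-+ (λ u → ∑ λ w → W u w * X u w) (λ u → ∑ λ w → W u w * Y u w))

cost-single² : ∀ {n} (W : Fin n → Fin n → ℕ) (a b : Fin n) → cost W (single² a b) ≡ W a b
cost-single² W a b = trans (∑-cong row) (∑-select (λ u → W u b) a)
  where
  row : ∀ u → ∑ (λ w → W u w * (single a u * single b w)) ≡ W u b * single a u
  row u = begin
    ∑ (λ w → W u w * (single a u * single b w)) ≡⟨ ∑-cong (λ w → *-comm (W u w) (single a u * single b w)) ⟩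
    ∑ (λ w → single a u * single b w * W u w)   ≡⟨ ∑-cong (λ w → *-assoc (single a u) (single b w) (W u w)) ⟩
    ∑ (λ w → single a u * (single b w * W u w)) ≡⟨ *-distribˡ-∑ (single a u) (λ w → single b w * W u w) ⟨
    single a u * ∑ (λ w → single b w * W u w)
      ≡⟨ cong (single a u *_) (trans (∑-cong (λ w → *-comm (single b w) (W u w))) (∑-select (W u) b)) ⟩
    single a u * W u b                          ≡⟨ *-comm (single a u) (W u b) ⟩
    W u b * single a u                          ∎
    where open ≡-Reasoning

cost-balance : ∀ {n} (W : Fin n → Fin n → ℕ) {M M' X Y : PairMultiset n} →
               (∀ u w → M' u w + X u w ≡ M u w + Y u w) → cost W M' + cost W X ≡ cost W M + cost W Y
cost-balance W {M} {M'} {X} {Y} balanced = begin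
  cost W M' + cost W X                  ≡⟨ cost-+ W M' X ⟨
  cost W (λ u w → M' u w + X u w)       ≡⟨ ∑-cong (λ u → ∑-cong (λ w → cong (W u w *_) (balanced u w))) ⟩
  cost W (λ u w → M u w + Y u w)        ≡⟨ cost-+ W M Y ⟩
  cost W M + cost W Y                   ∎
  where open ≡-Reasoning

transpose : ∀ {n} → PairMultiset n → PairMultiset n
transpose M u w = M w u

cost-transpose : ∀ {n} (W : Fin n → Fin n → ℕ) → (∀ u w → W u w ≡ W w u) →
                 (M : PairMultiset n) → cost W (transpose M) ≡ cost W M
cost-transpose W W-sym M = trans (∑-comm (λ u w → W u w * M w u))
                                 (∑-cong λ u → ∑-cong λ w → cong (_* M u w) (W-sym w u))

IsMatching-transpose : ∀ {n} {A B : Multiset n} {M : PairMultiset n} →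
                       IsMatching A B M → IsMatching B A (transpose M)
IsMatching-transpose (rows , columns) = columns , rows

IsMinCostMatching-transpose : ∀ {n} {W : Fin n → Fin n → ℕ} → (∀ u w → W u w ≡ W w u) →
  ∀ {A B : Multiset n} {M : PairMultiset n} → IsMinCostMatching W A B M → IsMinCostMatching W B A (transpose M)
IsMinCostMatching-transpose {W = W} W-sym {M = M} (matching , minimal) =
  IsMatching-transpose matching ,
  λ M' matching' → subst₂ _≤_ (sym (cost-transpose W W-sym M)) (cost-transpose W W-sym M')
                           (minimal (transpose M') (IsMatching-transpose matching'))

IsMinCostMatching-cheaper : ∀ {n} {W : Fin n → Fin n → ℕ} {A B : Multiset n} {M M' : PairMultiset n} →
  IsMinCostMatching W A B M → IsMatching A B M' → cost W M' ≤ cost W M → IsMinCostMatching W A B M'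
IsMinCostMatching-cheaper (_ , minimal) matching' M'≤M = matching' , λ M'' m'' → ≤-trans M'≤M (minimal M'' m'')

singles² : ∀ {n} → Fin n → Fin n → Fin n → Fin n → PairMultiset n
singles² a b c q u w = single² a b u w + single² c q u w

-- M' = M − {(a,b),(c,q)} + {(a,q),(c,b)}, stated additively to avoid truncated subtraction.
record Exchange {n} (M : PairMultiset n) (a b c q : Fin n) (M' : PairMultiset n) : Set where
  field balance : ∀ u w → M' u w + singles² a b c q u w ≡ M u w + singles² a q c b u w
open Exchange

exchange : ∀ {n} (M : PairMultiset n) {a b c q : Fin n} → 0 < M a b → 0 < M c q → ¬ (a ≡ c × b ≡ q) →
           Σ (PairMultiset n) (Exchange M a b c q)
exchange M {a} {b} {c} {q} 0<Mab 0<Mcq ≢ =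
  (λ u w → (M u w + singles² a q c b u w) ∸ singles² a b c q u w) ,
  record { balance = λ u w → m∸n+n≡m (≤-trans (removed≤M u w) (m≤m+n _ _)) }
  where
  removed≤M : ∀ u w → singles² a b c q u w ≤ M u w
  removed≤M u w with u ≟ a ×-dec w ≟ b
  ... | yes (refl , refl) rewrite single²-≡ a b | single²-≢ {a = c} {q} {a} {b} ≢ = 0<Mab
  ... | no ≢ab            rewrite single²-≢ {a = a} {b} {u} {w} ≢ab = single²-≤ M 0<Mcq u w

∑-row-singles² : ∀ {n} (a b c q u : Fin n) → ∑ (singles² a b c q u) ≡ single a u + single c u
∑-row-singles² a b c q u = trans (∑-distrib-+ (single² a b u) (single² c q u))
                                 (cong₂ _+_ (∑-row-single² a b u) (∑-row-single² c q u))

∑-column-singles² : ∀ {n} (a b c q w : Fin n) → ∑ (λ u → singles² a b c q u w) ≡ single b w + single q w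
∑-column-singles² a b c q w = trans (∑-distrib-+ (λ u → single² a b u w) (λ u → single² c q u w))
                                    (cong₂ _+_ (∑-column-single² a b w) (∑-column-single² c q w))

cost-singles² : ∀ {n} (W : Fin n → Fin n → ℕ) (a b c q : Fin n) → cost W (singles² a b c q) ≡ W a b + W c q
cost-singles² W a b c q = trans (cost-+ W (single² a b) (single² c q))
                                (cong₂ _+_ (cost-single² W a b) (cost-single² W c q))

exchange-isMatching : ∀ {n} {A B : Multiset n} {M M' : PairMultiset n} {a b c q : Fin n} →
  Exchange M a b c q M' → IsMatching A B M → IsMatching A B M'
exchange-isMatching {A = A} {B} {M} {M'} {a} {b} {c} {q} exchanged (rows , columns) = rows' , columns'
  where
  rows' : ∀ u → ∑ (M' u) ≡ A u
  rows' u = trans (+-cancelʳ-≡ (single a u + single c u) (∑ (M' u)) (∑ (M u))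
    (subst₂ (λ x y → ∑ (M' u) + x ≡ ∑ (M u) + y) (∑-row-singles² a b c q u) (∑-row-singles² a q c b u)
            (∑-balance (balance exchanged u))))
    (rows u)
  columns' : ∀ w → ∑ (λ u → M' u w) ≡ B w
  columns' w = trans (+-cancelʳ-≡ (single b w + single q w) (∑ (λ u → M' u w)) (∑ (λ u → M u w))
    (subst₂ (λ x y → ∑ (λ u → M' u w) + x ≡ ∑ (λ u → M u w) + y)
            (∑-column-singles² a b c q w) (trans (∑-column-singles² a q c b w) (+-comm (single q w) (single b w)))
            (∑-balance (λ u → balance exchanged u w))))
    (columns w)

exchange-cost : ∀ {n} (W : Fin n → Fin n → ℕ) {M M' : PairMultiset n} {a b c q : Fin n} →
  Exchange M a b c q M' → cost W M' + (W a b + W c q) ≡ cost W M + (W a q + W c b)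
exchange-cost W {M} {M'} {a} {b} {c} {q} exchanged =
  subst₂ (λ x y → cost W M' + x ≡ cost W M + y) (cost-singles² W a b c q) (cost-singles² W a q c b)
         (cost-balance W (balance exchanged))

≤-from-balance : ∀ {x y p q} → x + p ≡ y + q → q ≤ p → x ≤ y
≤-from-balance {x} {y} {p} {q} balanced q≤p = +-cancelʳ-≤ p x y (≤-trans (≤-reflexive balanced) (+-monoʳ-≤ y q≤p))

<-from-balance : ∀ {x y p q} → x + p ≡ y + q → q < p → x < y
<-from-balance {x} {y} {p} {q} balanced q<p =
  +-cancelʳ-< p x y (≤-trans (s≤s (≤-reflexive balanced))
                             (≤-trans (≤-reflexive (sym (+-suc y q))) (+-monoʳ-≤ y q<p)))

exchange-isMinCost : ∀ {n} {W : Fin n → Fin n → ℕ} {A B : Multiset n} {M M' : PairMultiset n} {a b c q : Fin n} →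
  IsMinCostMatching W A B M → Exchange M a b c q M' → W a q + W c b ≤ W a b + W c q → IsMinCostMatching W A B M'
exchange-isMinCost {W = W} minCost exchanged cheaper =
  IsMinCostMatching-cheaper {W = W} minCost (exchange-isMatching exchanged (proj₁ minCost))
                            (≤-from-balance (exchange-cost W exchanged) cheaper)

exchange-adds : ∀ {n} {M M' : PairMultiset n} {a b c q : Fin n} →
  Exchange M a b c q M' → q ≢ b → a ≢ c → 0 < M' a q
exchange-adds {M = M} {M'} {a} {b} {c} {q} exchanged q≢b a≢c =
  subst (0 <_) M'aq (≤-trans (≤-reflexive (sym (single²-≡ a q))) (≤-trans (m≤m+n _ _) (m≤n+m _ (M a q))))
  where
  M'aq : M a q + singles² a q c b a q ≡ M' a q
  M'aq = begin
    M a q + singles² a q c b a q ≡⟨ balance exchanged a q ⟨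
    M' a q + singles² a b c q a q
      ≡⟨ cong (M' a q +_) (cong₂ _+_ (single²-≢ {a = a} {b} {a} {q} (q≢b ∘ proj₂))
                                     (single²-≢ {a = c} {q} {a} {q} (a≢c ∘ proj₁))) ⟩
    M' a q + 0                    ≡⟨ +-identityʳ (M' a q) ⟩
    M' a q                        ∎
    where open ≡-Reasoning

partner : ∀ {n} {A B : Multiset n} {M : PairMultiset n} → IsMatching A B M →
          ∀ {u} → B u < A u → ∃[ w ] w ≢ u × 0 < M u w
partner {M = M} (rows , columns) {u} Bu<Au =
  ∃-other-positive-term (M u) u (≤-<-trans (≤-trans (≤-∑ (λ x → M x u) u) (≤-reflexive (columns u)))
                                          (subst (_ <_) (sym (rows u)) Bu<Au))

continue-row : ∀ {n} {A B : Multiset n} {M : PairMultiset n} → IsMatching A B M →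
               ∀ {u w} → 0 < M u w → u ≢ w → B w ≤ A w → ∃[ x ] x ≢ w × 0 < M w x
continue-row {M = M} (rows , columns) {u} {w} 0<Muw u≢w Bw≤Aw =
  ∃-other-positive-term (M w) w (<-≤-trans (m<n+m (M w w) 0<Muw)
    (≤-trans (+-≤-∑ (λ x → M x w) u≢w)
      (≤-trans (≤-reflexive (columns w)) (≤-trans Bw≤Aw (≤-reflexive (sym (rows w)))))))

discrete : ∀ {n} → Fin n → Fin n → ℕ
discrete u w = if does (u ≟ w) then 0 else 1

discrete-≡ : ∀ {n} (u : Fin n) → discrete u u ≡ 0
discrete-≡ u with u ≟ u
... | yes _   = refl
... | no  u≢u = ⊥-elim (u≢u refl)

discrete-≢ : ∀ {n} {u w : Fin n} → u ≢ w → discrete u w ≡ 1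
discrete-≢ {u = u} {w} u≢w with u ≟ w
... | yes u≡w = ⊥-elim (u≢w u≡w)
... | no  _   = refl

discrete-≤1 : ∀ {n} (u w : Fin n) → discrete u w ≤ 1
discrete-≤1 u w with u ≟ w
... | yes _ = z≤n
... | no  _ = s≤s z≤n

discrete-sym : ∀ {n} (u w : Fin n) → discrete u w ≡ discrete w u
discrete-sym u w with u ≟ w | w ≟ u
... | yes _   | yes _   = refl
... | no  _   | no  _   = refl
... | yes u≡w | no  w≢u = ⊥-elim (w≢u (sym u≡w))
... | no  u≢w | yes w≡u = ⊥-elim (u≢w (sym w≡u))

offDiagonal : ∀ {n} → PairMultiset n → ℕ
offDiagonal = cost discrete

offDiagonal-transpose : ∀ {n} (M : PairMultiset n) → offDiagonal (transpose M) ≡ offDiagonal M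
offDiagonal-transpose = cost-transpose discrete discrete-sym

shortcut : ∀ {n} {W : Fin n → Fin n → ℕ} → (∀ u → W u u ≡ 0) → (∀ a b c → W a c ≤ W a b + W b c) →
  ∀ {A B : Multiset n} {M : PairMultiset n} {a b c : Fin n} → IsMinCostMatching W A B M →
  0 < M a b → 0 < M b c → a ≢ b → b ≢ c →
  Σ (PairMultiset n) (λ M' → IsMinCostMatching W A B M' × offDiagonal M' < offDiagonal M)
shortcut {W = W} W-refl W-triangle {M = M} {a} {b} {c} minCost 0<Mab 0<Mbc a≢b b≢c
  with exchange M 0<Mab 0<Mbc (λ (a≡b , _) → a≢b a≡b)
... | M' , exchanged =
  M' , exchange-isMinCost {W = W} minCost exchanged cheaper , <-from-balance (exchange-cost discrete exchanged) fewer
  where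
  cheaper : W a c + W b b ≤ W a b + W b c
  cheaper = subst (_≤ W a b + W b c) (sym (trans (cong (W a c +_) (W-refl b)) (+-identityʳ (W a c))))
                  (W-triangle a b c)
  fewer : discrete a c + discrete b b < discrete a b + discrete b c
  fewer = subst₂ _<_ (sym (trans (cong (discrete a c +_) (discrete-≡ b)) (+-identityʳ (discrete a c))))
                     (sym (cong₂ _+_ (discrete-≢ a≢b) (discrete-≢ b≢c)))
                     (s≤s (discrete-≤1 a c))

-- Distances in a graph

module Distance {n} {E : Fin n → Fin n → Set} (E-sym : ∀ {u w} → E u w → E w u)
                (E-irrefl : ∀ {u w} → E u w → u ≢ w) {d : Fin n → Fin n → ℕ} (dist : IsDistance E d) where

  walk-snoc : ∀ {u w v k} → Walk E u w k → E w v → Walk E u v (suc k)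
  walk-snoc nil         e  = cons e nil
  walk-snoc (cons e₁ p) e₂ = cons e₁ (walk-snoc p e₂)

  walk-reverse : ∀ {u v k} → Walk E u v k → Walk E v u k
  walk-reverse nil        = nil
  walk-reverse (cons e p) = walk-snoc (walk-reverse p) (E-sym e)

  walk-++ : ∀ {u w v k m} → Walk E u w k → Walk E w v m → Walk E u v (k + m)
  walk-++ nil        q = q
  walk-++ (cons e p) q = cons e (walk-++ p q)

  geodesic : ∀ u v → Walk E u v (d u v)
  geodesic u v = proj₁ (dist u v)

  d≤length : ∀ {u v k} → Walk E u v k → d u v ≤ k
  d≤length {u} {v} {k} = proj₂ (dist u v) k

  d-sym : ∀ u v → d u v ≡ d v u
  d-sym u v = ≤-antisym (d≤length (walk-reverse (geodesic v u))) (d≤length (walk-reverse (geodesic u v)))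

  d-triangle : ∀ u w v → d u v ≤ d u w + d w v
  d-triangle u w v = d≤length (walk-++ (geodesic u w) (geodesic w v))

  d-refl : ∀ u → d u u ≡ 0
  d-refl u = n≤0⇒n≡0 (d≤length nil)

  d-pos : ∀ {u v} → u ≢ v → 0 < d u v
  d-pos {u} {v} u≢v = n≢0⇒n>0 (λ d≡0 → u≢v (endpoints-≡ (geodesic u v) d≡0))
    where
    endpoints-≡ : ∀ {u v k} → Walk E u v k → k ≡ 0 → u ≡ v
    endpoints-≡ nil _ = refl

  d-adj : ∀ {u v} → E u v → d u v ≡ 1
  d-adj e = ≤-antisym (d≤length (cons e nil)) (d-pos (E-irrefl e))

  adj-∈S : ∀ {u v} → E u v → InS E d u v v
  adj-∈S {u} {v} e = e , trans (d-adj e) (cong suc (sym (d-refl v)))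

  first-step : ∀ u v → u ≢ v → ∃[ g ] InS E d u v g
  first-step u v u≢v = step (geodesic u v) refl
    where
    step : ∀ {k} → Walk E u v k → d u v ≡ k → ∃[ g ] InS E d u v g
    step nil _ = ⊥-elim (u≢v refl)
    step (cons {w = g} e p) d≡k =
      g , e , ≤-antisym (d≤length (cons e (geodesic g v))) (subst (suc (d g v) ≤_) (sym d≡k) (s≤s (d≤length p)))

-- Interval graphs

module IntervalGraph {n} (I : IntervalRep n) where
  open IntervalRep I

  infix 4 _∼_ _∼?_

  _∼_ : Fin n → Fin n → Set
  _∼_ = Adj I

  ∼-sym : ∀ {u w} → u ∼ w → w ∼ u
  ∼-sym (u≢w , ℓu≤rw , ℓw≤ru) = u≢w ∘ sym , ℓw≤ru , ℓu≤rw

  ∼-irrefl : ∀ {u w} → u ∼ w → u ≢ w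
  ∼-irrefl = proj₁

  _∼?_ : ∀ u w → Dec (u ∼ w)
  u ∼? w = ¬? (u ≟ w) ×-dec ℓ u ≤? r w ×-dec ℓ w ≤? r u

  ∼⇒ℓ<r : ∀ {u w} → u ∼ w → ℓ u < r w
  ∼⇒ℓ<r {u} {w} (_ , ℓu≤rw , _) = ≤∧≢⇒< ℓu≤rw (ℓ≢r u w)

  ≁⇒r<ℓ : ∀ {u w} → ¬ u ∼ w → u ≢ w → ℓ u ≤ r w → r u < ℓ w
  ≁⇒r<ℓ u≁w u≢w ℓu≤rw = ≰⇒> (λ ℓw≤ru → u≁w (u≢w , ℓu≤rw , ℓw≤ru))

  r-< : ∀ {u w} → u ≢ w → r u ≤ r w → r u < r w
  r-< {u} {w} u≢w ru≤rw = ≤∧≢⇒< ru≤rw (u≢w ∘ r-inj u w)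

module IntervalDistance {n} (I : IntervalRep n) {d : Fin n → Fin n → ℕ} (dist : IsDistance (Adj I) d) where
  open IntervalRep I
  open IntervalGraph I
  open Distance ∼-sym ∼-irrefl dist

  -- The first vertex of the walk whose right end passes r b is b itself or adjacent to b.
  reroute : ∀ {a c k} → Walk _∼_ a c k → ∀ b → r a ≤ r b → r b < ℓ c → d b c ≤ k
  reroute {a} nil b ra≤rb rb<ℓc = ⊥-elim (<-irrefl refl (<-≤-trans (<-trans rb<ℓc (ℓ<r a)) ra≤rb))
  reroute (cons {w = w} a∼w p) b ra≤rb rb<ℓc with r w ≤? r b | w ≟ b
  ... | yes rw≤rb | _        = m≤n⇒m≤1+n (reroute p b rw≤rb rb<ℓc)
  ... | no  _     | yes refl = m≤n⇒m≤1+n (d≤length p)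
  ... | no  rw≰rb | no  w≢b  = d≤length (cons b∼w p)
    where
    b∼w : b ∼ w
    b∼w = w≢b ∘ sym , <⇒≤ (<-trans (ℓ<r b) (≰⇒> rw≰rb)) , ≤-trans (proj₂ (proj₂ a∼w)) ra≤rb

  Improvable : Multiset n → Multiset n → Set
  Improvable A B = Σ (PairMultiset n) λ M' →
    IsMinCostMatching d A B M' × (ImprovS _∼_ d A M' ⊎ ImprovT _∼_ d B M')

  transposed : ∀ {A B : Multiset n} {M : PairMultiset n} → IsMinCostMatching d A B M → IsMinCostMatching d B A (transpose M)
  transposed = IsMinCostMatching-transpose d-sym

  improvable-swap : ∀ {A B} → Improvable B A → Improvable A B
  improvable-swap (M' , minCost , improvement) = transpose M' , transposed minCost , swap improvement
    where
    swap : ∀ {A B} → ImprovS _∼_ d B M' ⊎ ImprovT _∼_ d A M' →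
                     ImprovS _∼_ d A (transpose M') ⊎ ImprovT _∼_ d B (transpose M')
    swap (inj₁ (u , w , u' , 0<M , u'∈S , dominating)) = inj₂ (w , u , u' , 0<M , u'∈S , dominating)
    swap (inj₂ (u , w , w' , 0<M , w'∈S , dominating)) = inj₁ (w , u , w' , 0<M , w'∈S , dominating)

  module Construction (A B : Multiset n) (A-dom : Dominating _∼_ A) (B-dom : Dominating _∼_ B)
    (M : PairMultiset n) (minCost : IsMinCostMatching d A B M)
    (v : Fin n) (v-leftmost : ∀ x → A x ≢ B x → r v ≤ r x) (Bv<Av : B v < A v)
    (normalise : ∀ {M₂} → IsMinCostMatching d A B M₂ → offDiagonal M₂ < offDiagonal M → Improvable A B)
    where

    matching : IsMatching A B M
    matching = proj₁ minCost

    recurse-via-shortcut : ∀ {a b c} → 0 < M a b → 0 < M b c → a ≢ b → b ≢ c → Improvable A B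
    recurse-via-shortcut 0<Mab 0<Mbc a≢b b≢c with shortcut d-refl d-triangle minCost 0<Mab 0<Mbc a≢b b≢c
    ... | M₂ , minCost₂ , fewer = normalise minCost₂ fewer

    v-leftmost-< : ∀ {x} → x ≢ v → A x ≢ B x → r v < r x
    v-leftmost-< x≢v Ax≢Bx = r-< (x≢v ∘ sym) (v-leftmost _ Ax≢Bx)

    agree-left-of-v : ∀ {x} → r x < r v → A x ≡ B x
    agree-left-of-v {x} rx<rv with A x ≟ℕ B x
    ... | yes Ax≡Bx = Ax≡Bx
    ... | no  Ax≢Bx = ⊥-elim (<⇒≱ rx<rv (v-leftmost x Ax≢Bx))

    surplus-at-v : 0 < B v → 2 ≤ A v
    surplus-at-v 0<Bv = ≤-<-trans 0<Bv Bv<Av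

    Candidate : Fin n → Set
    Candidate z = 0 < B z × A z ≡ 0 × r v < r z

    candidate? : ∀ z → Dec (Candidate z)
    candidate? z = 0 <? B z ×-dec A z ≟ℕ 0 ×-dec r v <? r z

    candidate : ∀ {z} → z ≢ v → 0 < B z → ¬ 0 < A z → Candidate z
    candidate {z} z≢v 0<Bz ¬0<Az =
      0<Bz , Az≡0 , v-leftmost-< z≢v (λ Az≡Bz → <⇒≢ 0<Bz (trans (sym Az≡0) Az≡Bz))
      where
      Az≡0 : A z ≡ 0
      Az≡0 = n≤0⇒n≡0 (≮⇒≥ ¬0<Az)

    module Partner (v' : Fin n) (v'≢v : v' ≢ v) (0<Mvv' : 0 < M v v') (rv<rv' : r v < r v') where

      -- Both choices of h below satisfy this; it is what makes the exchange in Exchanged cheap.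
      Bound : Fin n → Set
      Bound h = ∀ y → v ∼ y → 0 < B y → ℓ y < ℓ h → y ≢ v' → ¬ d v v' ≡ suc (d y v') →
                Improvable A B ⊎ r y < r h

      module Towards (h : Fin n) (h∈S : InS _∼_ d v v' h) (rv<rh : r v < r h) (bound : Bound h) where

        v∼h : v ∼ h
        v∼h = proj₁ h∈S

        ℓh<rv : ℓ h < r v
        ℓh<rv = ∼⇒ℓ<r (∼-sym v∼h)

        undominated⇒candidate : ¬ Dominating _∼_ (move A v h) → ∃[ z ] (Candidate z × ℓ z < ℓ h)
        undominated⇒candidate ¬dominating with undominated _∼?_ ¬dominating
        ... | x , ¬dominates = via-B (B-dom x)
          where
          h-added : 0 < move A v h h
          h-added = move-adds A v h
          x∼v : x ∼ v
          x∼v with ¬dominates-move⇒≡⊎adj {E = _∼_} (A-dom x) ¬dominates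
          ... | inj₁ refl = ⊥-elim (¬dominates (inj₂ (h , v∼h , h-added)))
          ... | inj₂ x∼v = x∼v
          x≢h : x ≢ h
          x≢h refl = ¬dominates (inj₁ h-added)
          rx<ℓh : r x < ℓ h
          rx<ℓh = ≁⇒r<ℓ (λ x∼h → ¬dominates (inj₂ (h , x∼h , h-added))) x≢h
                        (≤-trans (proj₁ (proj₂ x∼v)) (<⇒≤ rv<rh))
          via-B : Dominates _∼_ B x → ∃[ z ] (Candidate z × ℓ z < ℓ h)
          via-B (inj₁ 0<Bx) = ⊥-elim (¬dominates (inj₁ (move-keeps A (∼-irrefl x∼v)
                                (subst (0 <_) (sym (agree-left-of-v (<-trans rx<ℓh ℓh<rv))) 0<Bx))))
          via-B (inj₂ (z , x∼z , 0<Bz)) = z , candidate z≢v 0<Bz ¬0<Az , ≤-<-trans (proj₂ (proj₂ x∼z)) rx<ℓh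
            where
            z≢v : z ≢ v
            z≢v refl = ¬dominates (inj₂ (v , x∼v , move-keeps-surplus A h (surplus-at-v 0<Bz)))
            ¬0<Az : ¬ 0 < A z
            ¬0<Az 0<Az = ¬dominates (inj₂ (z , x∼z , move-keeps A z≢v 0<Az))

        module Chosen (y : Fin n) (y-candidate : Candidate y) (y-leftmost : ∀ z → Candidate z → ℓ y ≤ ℓ z)
                      (ℓy<ℓh : ℓ y < ℓ h) where

          0<By : 0 < B y
          0<By = proj₁ y-candidate

          rv<ry : r v < r y
          rv<ry = proj₂ (proj₂ y-candidate)

          ℓy<rv : ℓ y < r v
          ℓy<rv = <-trans ℓy<ℓh ℓh<rv

          ∼y : ∀ {a} → a ≢ y → ℓ a ≤ r v → ℓ y ≤ r a → a ∼ y
          ∼y a≢y ℓa≤rv ℓy≤ra = a≢y , ≤-trans ℓa≤rv (<⇒≤ rv<ry) , ℓy≤ra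

          v∼y : v ∼ y
          v∼y = ∼y (λ v≡y → <-irrefl (cong r v≡y) rv<ry) (<⇒≤ (ℓ<r v)) (<⇒≤ ℓy<rv)

          y-added : 0 < move A v y y
          y-added = move-adds A v y

          left-neighbour : ∀ {a} → a ∼ v → a ≢ y → ¬ 2 ≤ A v → r a < r v → Dominates _∼_ (move A v y) a
          left-neighbour {a} a∼v a≢y ¬surplus ra<rv with 0 <? A a | B-dom a
          ... | yes 0<Aa | _          = inj₁ (move-keeps A (∼-irrefl a∼v) 0<Aa)
          ... | no ¬0<Aa | inj₁ 0<Ba  = ⊥-elim (¬0<Aa (subst (0 <_) (sym (agree-left-of-v ra<rv)) 0<Ba))
          ... | no _     | inj₂ (z , a∼z , 0<Bz) with toSum (z ≟ v) | 0 <? A z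
          ...   | inj₁ refl | _          = ⊥-elim (¬surplus (surplus-at-v 0<Bz))
          ...   | inj₂ z≢v  | yes 0<Az   = inj₂ (z , a∼z , move-keeps A z≢v 0<Az)
          ...   | inj₂ z≢v  | no  ¬0<Az  =
            inj₂ (y , ∼y a≢y (proj₁ (proj₂ a∼v))
                         (≤-trans (y-leftmost z (candidate z≢v 0<Bz ¬0<Az)) (proj₂ (proj₂ a∼z))) , y-added)

          neighbour : ∀ {a} → a ∼ v → Dominates _∼_ (move A v y) a
          neighbour {a} a∼v with toSum (a ≟ y) | 2 ≤? A v | r v <? r a
          ... | inj₁ refl | _          | _         = inj₁ y-added
          ... | inj₂ _    | yes surplus | _        = inj₂ (v , a∼v , move-keeps-surplus A y surplus)
          ... | inj₂ a≢y  | no  _      | yes rv<ra =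
            inj₂ (y , ∼y a≢y (proj₁ (proj₂ a∼v)) (<⇒≤ (<-trans ℓy<rv rv<ra)) , y-added)
          ... | inj₂ a≢y  | no ¬surplus | no rv≮ra =
            left-neighbour a∼v a≢y ¬surplus (r-< (∼-irrefl a∼v) (≮⇒≥ rv≮ra))

          move-dominating : Dominating _∼_ (move A v y)
          move-dominating a with A-dom a
          ... | inj₁ 0<Aa with toSum (a ≟ v)
          ...   | inj₁ refl = inj₂ (y , v∼y , y-added)
          ...   | inj₂ a≢v  = inj₁ (move-keeps A a≢v 0<Aa)
          move-dominating a | inj₂ (w , a∼w , 0<Aw) with toSum (w ≟ v)
          ...   | inj₁ refl = neighbour a∼w
          ...   | inj₂ w≢v  = inj₂ (w , a∼w , move-keeps A w≢v 0<Aw)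

          improved-by-v : ∀ {v''} → 0 < M v v'' → InS _∼_ d v v'' y → Improvable A B
          improved-by-v 0<Mvv'' y∈S = M , minCost , inj₁ (v , _ , y , 0<Mvv'' , y∈S , move-dominating)

          module Exchanged (y' : Fin n) (y'≢y : y' ≢ y) (0<My'y : 0 < M y' y) (y'≢v : y' ≢ v)
                           (rv<ry' : r v < r y') (y≢v' : y ≢ v') (ry<rh : r y < r h) where

            -- y ends before h ends, and h ends before y' starts (unless they meet), so a geodesic
            -- from y to y' can be rerouted from h.
            d-y'h≤d-y'y : d y' h ≤ d y' y
            d-y'h≤d-y'y with toSum (y' ≟ h) | y' ∼? h
            ... | inj₁ refl | _        = ≤-trans (≤-reflexive (d-refl y')) z≤n
            ... | inj₂ _    | yes y'∼h = ≤-trans (≤-reflexive (d-adj y'∼h)) (d-pos y'≢y)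
            ... | inj₂ y'≢h | no  y'≁h = subst₂ _≤_ (d-sym h y') (d-sym y y')
                (reroute (geodesic y y') h (<⇒≤ ry<rh)
                         (≁⇒r<ℓ (y'≁h ∘ ∼-sym) (y'≢h ∘ sym) (<⇒≤ (<-trans ℓh<rv rv<ry'))))

            cheaper : d v y + d y' v' ≤ d v v' + d y' y
            cheaper = begin
              d v y + d y' v'       ≡⟨ cong (_+ d y' v') (d-adj v∼y) ⟩
              1 + d y' v'           ≤⟨ s≤s (d-triangle y' h v') ⟩
              1 + (d y' h + d h v') ≤⟨ s≤s (+-monoˡ-≤ (d h v') d-y'h≤d-y'y) ⟩
              1 + (d y' y + d h v') ≡⟨ cong suc (+-comm (d y' y) (d h v')) ⟩
              1 + (d h v' + d y' y) ≡⟨ cong (_+ d y' y) (proj₂ h∈S) ⟨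
              d v v' + d y' y       ∎
              where open ≤-Reasoning

            result : Improvable A B
            result with exchange M 0<Mvv' 0<My'y (λ (v≡y' , _) → y'≢v (sym v≡y'))
            ... | M' , exchanged =
              M' , exchange-isMinCost {W = d} minCost exchanged cheaper ,
              inj₁ (v , y , y , exchange-adds exchanged y≢v' (y'≢v ∘ sym) , adj-∈S v∼y , move-dominating)

          via-partner-of-y : y ≢ v' → r y < r h → Improvable A B
          via-partner-of-y y≢v' ry<rh
            with partner (IsMatching-transpose matching) (subst (_< B y) (sym (proj₁ (proj₂ y-candidate))) 0<By)
          ... | y' , y'≢y , 0<My'y with toSum (y' ≟ v)
          ...   | inj₁ refl = improved-by-v 0<My'y (adj-∈S v∼y)
          ...   | inj₂ y'≢v with A y' ≤? B y'
          ...     | no  Ay'≰By' = Exchanged.result y' y'≢y 0<My'y y'≢v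
                                    (v-leftmost-< y'≢v (λ Ay'≡By' → Ay'≰By' (≤-reflexive Ay'≡By'))) y≢v' ry<rh
          ...     | yes Ay'≤By' with continue-row (IsMatching-transpose matching) 0<My'y (y'≢y ∘ sym) Ay'≤By'
          ...       | w , w≢y' , 0<Mwy' = recurse-via-shortcut 0<Mwy' 0<My'y w≢y' y'≢y

          ∉S⇒y≢v' : ¬ d v v' ≡ suc (d y v') → y ≢ v'
          ∉S⇒y≢v' y∉S refl = y∉S (proj₂ (adj-∈S v∼y))

          result : Improvable A B
          result with d v v' ≟ℕ suc (d y v')
          ... | yes y∈S = improved-by-v 0<Mvv' (v∼y , y∈S)
          ... | no  y∉S with bound y v∼y 0<By ℓy<ℓh (∉S⇒y≢v' y∉S) y∉S
          ...   | inj₁ improvable = improvable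
          ...   | inj₂ ry<rh      = via-partner-of-y (∉S⇒y≢v' y∉S) ry<rh

        result : Improvable A B
        result with dominating? _∼?_ (move A v h)
        ... | yes dominating = M , minCost , inj₁ (v , v' , h , 0<Mvv' , h∈S , dominating)
        ... | no ¬dominating with undominated⇒candidate ¬dominating
        ...   | z , z-candidate , ℓz<ℓh with argmin candidate? ℓ z-candidate
        ...     | y , y-candidate , y-leftmost =
          Chosen.result y y-candidate y-leftmost (≤-<-trans (y-leftmost z z-candidate) ℓz<ℓh)

      -- When h = v', a vertex that only v' dominates in B certifies that y ends left of v'.
      bound-adjacent : v ∼ v' → Bound v'
      bound-adjacent v∼v' y v∼y 0<By ℓy<ℓv' y≢v' _ with dominating? _∼?_ (move B v' v)
      ... | yes dominating = inj₁ (M , minCost , inj₂ (v , v' , v , 0<Mvv' , adj-∈S (∼-sym v∼v') , dominating))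
      ... | no ¬dominating with undominated _∼?_ ¬dominating
      ...   | q , ¬dominates = inj₂ (<-≤-trans (≁⇒r<ℓ y≁q y≢q (<⇒≤ (<-≤-trans ℓy<ℓv' (proj₂ (proj₂ q∼v')))))
                                              (proj₁ (proj₂ q∼v')))
        where
        y-kept : 0 < move B v' v y
        y-kept = move-keeps B y≢v' 0<By
        y≢q : y ≢ q
        y≢q refl = ¬dominates (inj₁ y-kept)
        y≁q : ¬ y ∼ q
        y≁q y∼q = ¬dominates (inj₂ (y , ∼-sym y∼q , y-kept))
        q∼v' : q ∼ v'
        q∼v' with ¬dominates-move⇒≡⊎adj {E = _∼_} (B-dom q) ¬dominates
        ... | inj₁ refl = ⊥-elim (¬dominates (inj₂ (v , ∼-sym v∼v' , move-adds B v' v)))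
        ... | inj₂ q∼v' = q∼v'

      module NonAdjacent (v≁v' : ¬ v ∼ v') (g : Fin n) (g∈S : InS _∼_ d v v' g) where

        rv<ℓv' : r v < ℓ v'
        rv<ℓv' = ≁⇒r<ℓ v≁v' (v'≢v ∘ sym) (<⇒≤ (<-trans (ℓ<r v) rv<rv'))

        g≢v' : g ≢ v'
        g≢v' refl = v≁v' (proj₁ g∈S)

        rv<rg : r v < r g
        rv<rg with r v <? r g
        ... | yes rv<rg = rv<rg
        ... | no  rv≮rg = ⊥-elim (<⇒≱ (subst (d g v' <_) (sym (proj₂ g∈S)) ≤-refl)
                                      (reroute (geodesic g v') v (≮⇒≥ rv≮rg) rv<ℓv'))

        bound : Bound g
        bound y v∼y 0<By ℓy<ℓg y≢v' y∉S with r y <? r g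
        ... | yes ry<rg = inj₂ ry<rg
        ... | no  ry≮rg =
          ⊥-elim (y∉S (≤-antisym via-y (≤-trans (s≤s d-yv'≤d-gv') (≤-reflexive (sym (proj₂ g∈S))))))
          where
          via-y : d v v' ≤ suc (d y v')
          via-y = subst (d v v' ≤_) (cong (_+ d y v') (d-adj v∼y)) (d-triangle v y v')
          d-yv'≤d-gv' : d y v' ≤ d g v'
          d-yv'≤d-gv' with y ∼? v'
          ... | yes y∼v' = ≤-trans (≤-reflexive (d-adj y∼v')) (d-pos g≢v')
          ... | no  y≁v' = reroute (geodesic g v') y (≮⇒≥ ry≮rg)
                                   (≁⇒r<ℓ y≁v' y≢v' (≤-trans (proj₂ (proj₂ v∼y)) (<⇒≤ rv<rv')))

      result : Improvable A B
      result with v ∼? v'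
      ... | yes v∼v' = Towards.result v' (adj-∈S v∼v') rv<rv' (bound-adjacent v∼v')
      ... | no  v≁v' with first-step v v' (v'≢v ∘ sym)
      ...   | g , g∈S = Towards.result g g∈S (NonAdjacent.rv<rg v≁v' g g∈S) (NonAdjacent.bound v≁v' g g∈S)

    result : Improvable A B
    result with partner matching Bv<Av
    ... | v' , v'≢v , 0<Mvv' with B v' ≤? A v'
    ...   | yes Bv'≤Av' with continue-row matching 0<Mvv' (v'≢v ∘ sym) Bv'≤Av'
    ...     | c , c≢v' , 0<Mv'c = recurse-via-shortcut 0<Mvv' 0<Mv'c (v'≢v ∘ sym) (c≢v' ∘ sym)
    result | v' , v'≢v , 0<Mvv' | no Bv'≰Av' =
      Partner.result v' v'≢v 0<Mvv' (v-leftmost-< v'≢v (λ Av'≡Bv' → Bv'≰Av' (≤-reflexive (sym Av'≡Bv'))))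

  improvable : ∀ {A B} → Dominating _∼_ A → Dominating _∼_ B → ∀ {x₀} → A x₀ ≢ B x₀ →
               ∀ {M} → IsMinCostMatching d A B M → Acc _<_ (offDiagonal M) → Improvable A B
  improvable {A} {B} A-dom B-dom A≢B {M} minCost (acc rs)
    with argmin (λ x → ¬? (A x ≟ℕ B x)) r A≢B
  ... | v , Av≢Bv , v-leftmost with <-cmp (B v) (A v)
  ...   | tri< Bv<Av _ _ = Construction.result A B A-dom B-dom M minCost v v-leftmost Bv<Av
                             (λ minCost₂ fewer → improvable A-dom B-dom A≢B minCost₂ (rs fewer))
  ...   | tri≈ _ Bv≡Av _ = ⊥-elim (Av≢Bv (sym Bv≡Av))
  ...   | tri> _ _ Av<Bv = improvable-swap (Construction.result B A B-dom A-dom (transpose M) (transposed minCost)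
                                             v (λ x Bx≢Ax → v-leftmost x (Bx≢Ax ∘ sym)) Av<Bv normalise)
    where
    normalise : ∀ {M₂} → IsMinCostMatching d B A M₂ → offDiagonal M₂ < offDiagonal (transpose M) → Improvable B A
    normalise {M₂} minCost₂ fewer = improvable-swap (improvable A-dom B-dom A≢B (transposed minCost₂)
      (rs (subst₂ _<_ (sym (offDiagonal-transpose M₂)) (offDiagonal-transpose M) fewer)))

lemma7 : ∀ {n : ℕ} (I : IntervalRep n) (d : Fin n → Fin n → ℕ) →
    IsDistance (Adj I) d →
    (Ds Dt : Multiset n) →
    Dominating (Adj I) Ds → Dominating (Adj I) Dt →
    ¬ (∀ x → Ds x ≡ Dt x) →
    size Ds ≡ size Dt →
    (M : PairMultiset n) → IsMinCostMatching d Ds Dt M →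
    ¬ ImprovS (Adj I) d Ds M →
    ¬ ImprovT (Adj I) d Dt M →
    Σ (PairMultiset n) (λ M' → IsMinCostMatching d Ds Dt M' ×
      (ImprovS (Adj I) d Ds M' ⊎ ImprovT (Adj I) d Dt M'))
lemma7 {n} I d dist Ds Dt Ds-dom Dt-dom Ds≢Dt _ M minCost _ _
  with ¬∀⟶∃¬ n (λ x → Ds x ≡ Dt x) (λ x → Ds x ≟ℕ Dt x) Ds≢Dt
... | x₀ , Dsx₀≢Dtx₀ =
  IntervalDistance.improvable I dist Ds-dom Dt-dom Dsx₀≢Dtx₀ minCost (<-wellFounded (offDiagonal M))
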